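{- Let $b \geq 2$ and $k \geq 1$ be integers. For $n \geq 1$ put $c_k^b(n) := \frac{b^{kn}-1}{b^n-1} = 1 + b^n + b^{2n} + \cdots + b^{(k-1)n}$, and let $$\mathcal{S}_k^b := \{0\} \cup \{ a \cdot c_k^b(n) \ : \ n \geq 1,\ b^{n-1} \leq a < b^n \}$$ be the set of base-$b$ $k$'th powers. Define \begin{align*} A_k &= \gcd(\mathcal{S}_k^b), \\ B_k &= \gcd(c_k^b(1), c_k^b(2), c_k^b(3), \ldots), \\ C_k &= \gcd(c_k^b(1), c_k^b(2), \ldots, c_k^b(k)), \\ D_k &= \gcd(c_k^b(1), c_k^b(k)), \\ E_k &= \gcd\!\left(\frac{b^k-1}{b-1},\, k\right). \end{align*} Then $A_k = B_k = C_k = D_k = E_k$.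
   Context: A natural number $N$ is called a base-$b$ $k$'th power if its canonical base-$b$ representation (without leading zeros) consists of $k$ consecutive identical blocks; $0$ is counted as one. Equivalently, $N=0$ or $N = a\cdot c_k^b(n)$ with $n \geq 1$ and $b^{n-1} \leq a < b^n$; this is the set $\mathcal{S}_k^b$ of the claim. The gcd of an infinite set of integers means the greatest common divisor of all its elements. -}

module Defs where

open import Data.Nat using (ℕ; zero; suc; _+_; _*_; _∸_; _^_; _≤_; _<_)
open import Data.Nat.Divisibility using (_∣_)
open import Data.Nat.DivMod using (_/_)
open import Data.Nat.GCD using (gcd)
open import Data.List using (List; map; foldr; upTo)
open import Data.Product using (_×_; ∃-syntax)
open import Data.Sum using (_⊎_)
open import Relation.Binary.PropositionalEquality using (_≡_)

c : ℕ → ℕ → ℕ → ℕ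
c b zero    n = 0
c b (suc k) n = c b k n + b ^ (k * n)

IsGCDOf : (ℕ → Set) → ℕ → Set
IsGCDOf P d = (∀ x → P x → d ∣ x) × (∀ e → (∀ x → P x → e ∣ x) → e ∣ d)

S : ℕ → ℕ → ℕ → Set
S b k N = N ≡ 0 ⊎ ∃[ n ] ∃[ a ] (1 ≤ n × b ^ (n ∸ 1) ≤ a × a < b ^ n × N ≡ a * c b k n)

Cvals : ℕ → ℕ → ℕ → Set
Cvals b k x = ∃[ n ] (1 ≤ n × x ≡ c b k n)

Ck : ℕ → ℕ → ℕ
Ck b k = foldr gcd 0 (map (λ i → c b k (suc i)) (upTo k))

Dk : ℕ → ℕ → ℕ
Dk b k = gcd (c b k 1) (c b k k)

-- E_k = gcd((b^k - 1)/(b - 1), k); only meaningful for b ≥ 2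
Ek : ℕ → ℕ → ℕ
Ek (suc (suc b')) k = gcd ((suc (suc b') ^ k ∸ 1) / suc b') k
Ek _ k = 0

-- Write c(n) = 1 + x + ... + x^(k-1) with x = b^n, and let d = gcd(c(1), k). As c(1) divides
-- b^k - 1, which divides b^(nk) - 1 = x^k - 1 = (x - 1) c(n), d divides both k and x^k - 1.
-- Any q dividing k and x^k - 1 divides c(n): if gcd(q, x - 1) = 1 this is Euclid's lemma;
-- otherwise w = gcd(q, x - 1) splits the sum as (1 + x + ... + x^(w-1)) (1 + x^w + ... + x^(k-w)),
-- whose first factor is ≡ w (mod x - 1) and whose second is divisible by q / w by induction.
-- Conversely c(k) ≡ k (mod c(1)), so gcd(c(1), c(k)) = d. Finally, a base-b k'th power is a
-- multiple of some c(n), and c(n) is the difference of the k'th powers with blocks b^(n-1) + 1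
-- and b^(n-1).
module Submission where

open import Defs
open import Data.Nat using (ℕ; _≤_)
open import Data.Product using (_×_)
open import Relation.Binary.PropositionalEquality using (_≡_)

open import Data.Nat.Base using (zero; suc; _+_; _*_; _∸_; _^_; _<_; z≤n; s≤s)
open import Data.Nat.Properties
open import Data.Nat.Divisibility
open import Data.Nat.DivMod using (_/_; m*n/n≡m)
open import Data.Nat.GCD using (gcd; gcd[m,n]∣m; gcd[m,n]∣n; gcd-greatest; gcd[m,n]≢0)
open import Data.Nat.Coprimality using (coprime-divisor; gcd≡1⇒coprime)
open import Data.Nat.Induction using (<-rec)
open import Data.Nat.Tactic.RingSolver using (solve-∀)
open import Data.List using ([]; _∷_; map; foldr; upTo)
open import Data.List.Membership.Propositional using (_∈_)
open import Data.List.Relation.Unary.Any using (here; there)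
open import Data.List.Membership.Propositional.Properties using (∈-map⁺; ∈-map⁻; ∈-upTo⁺)
open import Data.Product using (_,_; proj₁; proj₂; ∃-syntax)
open import Data.Sum using (inj₁; inj₂)
open import Relation.Nullary using (contradiction)
open import Relation.Binary.PropositionalEquality
  using (refl; sym; trans; cong; cong₂; subst; subst₂; module ≡-Reasoning)

geomSum : ℕ → ℕ → ℕ
geomSum zero    x = 0
geomSum (suc k) x = geomSum k x + x ^ k

c≡geomSum : ∀ b k n → c b k n ≡ geomSum k (b ^ n)
c≡geomSum b zero    n = refl
c≡geomSum b (suc k) n =
  cong₂ _+_ (c≡geomSum b k n) (trans (cong (b ^_) (*-comm k n)) (sym (^-*-assoc b n k)))

geomSum-+ : ∀ m n x → geomSum (m + n) x ≡ geomSum m x + x ^ m * geomSum n x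
geomSum-+ m zero x = begin
  geomSum (m + 0) x          ≡⟨ cong (λ j → geomSum j x) (+-identityʳ m) ⟩
  geomSum m x                ≡⟨ +-identityʳ (geomSum m x) ⟨
  geomSum m x + 0            ≡⟨ cong (geomSum m x +_) (*-zeroʳ (x ^ m)) ⟨
  geomSum m x + x ^ m * 0    ∎
  where open ≡-Reasoning
geomSum-+ m (suc n) x = begin
  geomSum (m + suc n) x                                ≡⟨ cong (λ j → geomSum j x) (+-suc m n) ⟩
  geomSum (m + n) x + x ^ (m + n)                      ≡⟨ cong₂ _+_ (geomSum-+ m n x) (^-distribˡ-+-* x m n) ⟩
  geomSum m x + x ^ m * geomSum n x + x ^ m * x ^ n    ≡⟨ +-assoc (geomSum m x) _ _ ⟩
  geomSum m x + (x ^ m * geomSum n x + x ^ m * x ^ n)  ≡⟨ cong (geomSum m x +_) (*-distribˡ-+ (x ^ m) _ _) ⟨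
  geomSum m x + x ^ m * (geomSum n x + x ^ n)          ∎
  where open ≡-Reasoning

geomSum-* : ∀ m n x → geomSum (m * n) x ≡ geomSum m x * geomSum n (x ^ m)
geomSum-* m zero x = trans (cong (λ j → geomSum j x) (*-zeroʳ m)) (sym (*-zeroʳ (geomSum m x)))
geomSum-* m (suc n) x = begin
  geomSum (m * suc n) x                                  ≡⟨ cong (λ j → geomSum j x) (trans (*-suc m n) (+-comm m (m * n))) ⟩
  geomSum (m * n + m) x                                  ≡⟨ geomSum-+ (m * n) m x ⟩
  geomSum (m * n) x + x ^ (m * n) * geomSum m x          ≡⟨ cong₂ _+_ (geomSum-* m n x) (cong (_* G) (sym (^-*-assoc x m n))) ⟩
  G * geomSum n (x ^ m) + (x ^ m) ^ n * G                ≡⟨ cong (G * geomSum n (x ^ m) +_) (*-comm ((x ^ m) ^ n) G) ⟩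
  G * geomSum n (x ^ m) + G * (x ^ m) ^ n                ≡⟨ *-distribˡ-+ G _ _ ⟨
  G * (geomSum n (x ^ m) + (x ^ m) ^ n)                  ∎
  where
  open ≡-Reasoning
  G = geomSum m x

geomSum-telescope : ∀ a k → suc a ^ k ≡ suc (a * geomSum k (suc a))
geomSum-telescope a zero    = cong suc (sym (*-zeroʳ a))
geomSum-telescope a (suc k) = begin
  suc a * suc a ^ k                      ≡⟨ cong (suc a *_) (geomSum-telescope a k) ⟩
  suc a * suc (a * G)                    ≡⟨ expand a G ⟩
  suc (a * (G + suc (a * G)))            ≡⟨ cong (λ y → suc (a * (G + y))) (geomSum-telescope a k) ⟨
  suc (a * (G + suc a ^ k))              ∎
  where
  open ≡-Reasoning
  G = geomSum k (suc a)
  expand : ∀ a g → suc a * suc (a * g) ≡ suc (a * (g + suc (a * g)))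
  expand = solve-∀

^∸1≡*geomSum : ∀ a k → suc a ^ k ∸ 1 ≡ a * geomSum k (suc a)
^∸1≡*geomSum a k = cong (_∸ 1) (geomSum-telescope a k)

a∣[1+a]^n∸1 : ∀ a n → a ∣ suc a ^ n ∸ 1
a∣[1+a]^n∸1 a n = subst (a ∣_) (sym (^∸1≡*geomSum a n)) (m∣m*n (geomSum n (suc a)))

-- Each power (1 + a)^i is ≡ 1 mod a, so the k-term sum is ≡ k mod a.
geomSum≡k+a*t : ∀ a k → ∃[ t ] geomSum k (suc a) ≡ k + a * t
geomSum≡k+a*t a zero = 0 , sym (*-zeroʳ a)
geomSum≡k+a*t a (suc k) with geomSum≡k+a*t a k
... | t , eq = t + geomSum k (suc a) , (begin
  geomSum k (suc a) + suc a ^ k              ≡⟨ cong₂ _+_ eq (geomSum-telescope a k) ⟩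
  k + a * t + suc (a * geomSum k (suc a))    ≡⟨ regroup k a t (geomSum k (suc a)) ⟩
  suc k + a * (t + geomSum k (suc a))        ∎)
  where
  open ≡-Reasoning
  regroup : ∀ k a t g → k + a * t + suc (a * g) ≡ suc k + a * (t + g)
  regroup = solve-∀

∣a⇒∣k⇒∣geomSum : ∀ {q} a k → q ∣ a → q ∣ k → q ∣ geomSum k (suc a)
∣a⇒∣k⇒∣geomSum a k q∣a q∣k with geomSum≡k+a*t a k
... | t , eq = subst (_ ∣_) (sym eq) (∣m∣n⇒∣m+n q∣k (∣m⇒∣m*n t q∣a))

∣geomSum-factor : ∀ {q' w} a r → w ∣ a → q' ∣ geomSum r (suc a ^ w) →
                  q' * w ∣ geomSum (w * r) (suc a)
∣geomSum-factor {q'} {w} a r w∣a q'∣G = begin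
  q' * w                                        ∣⟨ *-pres-∣ q'∣G (∣a⇒∣k⇒∣geomSum a w w∣a ∣-refl) ⟩
  geomSum r (suc a ^ w) * geomSum w (suc a)      ≡⟨ *-comm (geomSum r (suc a ^ w)) _ ⟩
  geomSum w (suc a) * geomSum r (suc a ^ w)      ≡⟨ geomSum-* w r (suc a) ⟨
  geomSum (w * r) (suc a)                        ∎
  where open ∣-Reasoning

∣k⇒∣[1+a]^k∸1⇒∣geomSum : ∀ q k a → q ∣ k → q ∣ suc a ^ k ∸ 1 → q ∣ geomSum k (suc a)
∣k⇒∣[1+a]^k∸1⇒∣geomSum = <-rec _ step
  where
  step : ∀ q → (∀ {q'} → q' < q → ∀ k a → q' ∣ k → q' ∣ suc a ^ k ∸ 1 → q' ∣ geomSum k (suc a)) →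
         ∀ k a → q ∣ k → q ∣ suc a ^ k ∸ 1 → q ∣ geomSum k (suc a)
  step zero _ k a 0∣k _ rewrite 0∣⇒≡0 0∣k = 0 ∣0
  step q@(suc _) rec k a q∣k q∣x^k∸1 with gcd q a in gcd≡w
  ... | zero = contradiction gcd≡w (gcd[m,n]≢0 q a (inj₁ λ ()))
  ... | suc zero =
    coprime-divisor (gcd≡1⇒coprime {q} {a} gcd≡w) (subst (q ∣_) (^∸1≡*geomSum a k) q∣x^k∸1)
  ... | w@(suc (suc _)) =
    subst₂ _∣_ (sym (m∣n⇒n≡quotient*m w∣q)) (cong (λ j → geomSum j (suc a)) (sym k≡w*r))
      (∣geomSum-factor a r w∣a (subst (_ ∣_) (cong (λ y → geomSum r y) (sym x^w≡1+a')) q'∣G))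
    where
    w∣q : w ∣ q
    w∣q = subst (_∣ q) gcd≡w (gcd[m,n]∣m q a)
    w∣a : w ∣ a
    w∣a = subst (_∣ a) gcd≡w (gcd[m,n]∣n q a)
    q' = quotient w∣q
    q'∣q : q' ∣ q
    q'∣q = quotient-∣ w∣q
    w∣k : w ∣ k
    w∣k = ∣-trans w∣q q∣k
    r = quotient w∣k
    k≡w*r : k ≡ w * r
    k≡w*r = m∣n⇒n≡m*quotient w∣k
    k≡r*w : k ≡ r * w
    k≡r*w = m∣n⇒n≡quotient*m w∣k
    q'∣r : q' ∣ r
    q'∣r = *-cancelʳ-∣ w (subst₂ _∣_ (m∣n⇒n≡quotient*m w∣q) k≡r*w q∣k)
    a' = a * geomSum w (suc a)
    x^w≡1+a' : suc a ^ w ≡ suc a'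
    x^w≡1+a' = geomSum-telescope a w
    [1+a']^r≡x^k : suc a' ^ r ≡ suc a ^ k
    [1+a']^r≡x^k = trans (cong (_^ r) (sym x^w≡1+a'))
                     (trans (^-*-assoc (suc a) w r) (cong (suc a ^_) (sym k≡w*r)))
    q'∣G : q' ∣ geomSum r (suc a')
    q'∣G = rec (quotient-< w∣q) r a' q'∣r
             (∣-trans q'∣q (subst (λ y → q ∣ y ∸ 1) (sym [1+a']^r≡x^k) q∣x^k∸1))

c[1]≡geomSum : ∀ b k → c b k 1 ≡ geomSum k b
c[1]≡geomSum b k = trans (c≡geomSum b k 1) (cong (geomSum k) (^-identityʳ b))

gcd[c[1],k]∣c : ∀ b k n → gcd (geomSum k (suc b)) k ∣ c (suc b) k n
gcd[c[1],k]∣c b k n = subst (d ∣_) (sym c≡geomSum[1+A])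
  (∣k⇒∣[1+a]^k∸1⇒∣geomSum d k A (gcd[m,n]∣n (geomSum k x) k) d∣[1+A]^k∸1)
  where
  x = suc b
  d = gcd (geomSum k x) k
  A = b * geomSum n x
  P = b * geomSum k x
  c≡geomSum[1+A] : c x k n ≡ geomSum k (suc A)
  c≡geomSum[1+A] = trans (c≡geomSum x k n) (cong (geomSum k) (geomSum-telescope b n))
  d∣[1+A]^k∸1 : d ∣ suc A ^ k ∸ 1
  d∣[1+A]^k∸1 = begin
    d                    ∣⟨ gcd[m,n]∣m (geomSum k x) k ⟩
    geomSum k x          ∣⟨ n∣m*n b ⟩
    P                    ∣⟨ a∣[1+a]^n∸1 P n ⟩
    suc P ^ n ∸ 1        ≡⟨ cong (λ y → y ^ n ∸ 1) (geomSum-telescope b k) ⟨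
    (x ^ k) ^ n ∸ 1      ≡⟨ cong (_∸ 1) [x^k]^n≡[x^n]^k ⟩
    (x ^ n) ^ k ∸ 1      ≡⟨ cong (λ y → y ^ k ∸ 1) (geomSum-telescope b n) ⟩
    suc A ^ k ∸ 1        ∎
    where
    open ∣-Reasoning
    [x^k]^n≡[x^n]^k : (x ^ k) ^ n ≡ (x ^ n) ^ k
    [x^k]^n≡[x^n]^k = trans (^-*-assoc x k n) (trans (cong (x ^_) (*-comm k n)) (sym (^-*-assoc x n k)))

∣c[1]⇒∣c[k]⇒∣k : ∀ {e} b k → e ∣ c (suc b) k 1 → e ∣ c (suc b) k k → e ∣ k
∣c[1]⇒∣c[k]⇒∣k {e} b k e∣c[1] e∣c[k] = ∣m+n∣m⇒∣n (subst (e ∣_) (+-comm k (P * t)) e∣k+P*t) e∣P*t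
  where
  P = b * geomSum k (suc b)
  t = proj₁ (geomSum≡k+a*t P k)
  e∣P*t : e ∣ P * t
  e∣P*t = ∣m⇒∣m*n t (∣n⇒∣m*n b (subst (e ∣_) (c[1]≡geomSum (suc b) k) e∣c[1]))
  e∣k+P*t : e ∣ k + P * t
  e∣k+P*t = subst (e ∣_) (begin
    c (suc b) k k                         ≡⟨ c≡geomSum (suc b) k k ⟩
    geomSum k (suc b ^ k)                 ≡⟨ cong (geomSum k) (geomSum-telescope b k) ⟩
    geomSum k (suc P)                     ≡⟨ proj₂ (geomSum≡k+a*t P k) ⟩
    k + P * t                             ∎) e∣c[k]
    where open ≡-Reasoning

Dk≡gcd[c[1],k] : ∀ b k → Dk (suc b) k ≡ gcd (geomSum k (suc b)) k
Dk≡gcd[c[1],k] b k = ∣-antisym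
  (gcd-greatest (subst (Dk x k ∣_) c[1]≡G (gcd[m,n]∣m c[1] c[k]))
                (∣c[1]⇒∣c[k]⇒∣k b k (gcd[m,n]∣m c[1] c[k]) (gcd[m,n]∣n c[1] c[k])))
  (gcd-greatest (subst (d ∣_) (sym c[1]≡G) (gcd[m,n]∣m (geomSum k x) k)) (gcd[c[1],k]∣c b k k))
  where
  x = suc b
  c[1] = c x k 1
  c[k] = c x k k
  d = gcd (geomSum k x) k
  c[1]≡G : c[1] ≡ geomSum k x
  c[1]≡G = c[1]≡geomSum x k

Ek≡gcd[c[1],k] : ∀ b k → Ek (suc (suc b)) k ≡ gcd (geomSum k (suc (suc b))) k
Ek≡gcd[c[1],k] b k = cong (λ y → gcd y k) (begin
  (suc (suc b) ^ k ∸ 1) / suc b     ≡⟨ cong (_/ suc b) (^∸1≡*geomSum (suc b) k) ⟩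
  suc b * G / suc b                 ≡⟨ cong (_/ suc b) (*-comm (suc b) G) ⟩
  G * suc b / suc b                 ≡⟨ m*n/n≡m G (suc b) ⟩
  G                                 ∎)
  where
  open ≡-Reasoning
  G = geomSum k (suc (suc b))

CommonDivisor : (ℕ → Set) → ℕ → Set
CommonDivisor P e = ∀ x → P x → e ∣ x

gcd-isGCDOf : ∀ {P : ℕ → Set} {x y} → CommonDivisor P (gcd x y) → P x → P y → IsGCDOf P (gcd x y)
gcd-isGCDOf cd px py = cd , λ e e-cd → gcd-greatest (e-cd _ px) (e-cd _ py)

isGCDOf-unique : ∀ {P : ℕ → Set} {d d'} → IsGCDOf P d → IsGCDOf P d' → d ≡ d'
isGCDOf-unique (d-cd , d-greatest) (d'-cd , d'-greatest) =
  ∣-antisym (d'-greatest _ d-cd) (d-greatest _ d'-cd)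

isGCDOf-transfer : ∀ {P Q : ℕ → Set} {d} →
                   (∀ e → CommonDivisor P e → CommonDivisor Q e) →
                   (∀ e → CommonDivisor Q e → CommonDivisor P e) →
                   IsGCDOf P d → IsGCDOf Q d
isGCDOf-transfer P⇒Q Q⇒P (d-cd , d-greatest) = P⇒Q _ d-cd , λ e e-cd → d-greatest e (Q⇒P e e-cd)

foldr-gcd-isGCDOf : ∀ xs → IsGCDOf (_∈ xs) (foldr gcd 0 xs)
foldr-gcd-isGCDOf [] = (λ _ ()) , λ e _ → e ∣0
foldr-gcd-isGCDOf (x ∷ xs) with foldr-gcd-isGCDOf xs
... | g-cd , g-greatest =
  (λ { _ (here refl) → gcd[m,n]∣m x _ ; y (there y∈xs) → ∣-trans (gcd[m,n]∣n x _) (g-cd y y∈xs) }) ,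
  λ e e-cd → gcd-greatest (e-cd x (here refl)) (g-greatest e λ y y∈xs → e-cd y (there y∈xs))

Cvals-isGCDOf : ∀ b k → 1 ≤ k → IsGCDOf (Cvals (suc b) k) (Dk (suc b) k)
Cvals-isGCDOf b k 1≤k = gcd-isGCDOf Dk-cd (1 , ≤-refl , refl) (k , 1≤k , refl)
  where
  Dk-cd : CommonDivisor (Cvals (suc b) k) (Dk (suc b) k)
  Dk-cd _ (n , _ , refl) = subst (_∣ c (suc b) k n) (sym (Dk≡gcd[c[1],k] b k)) (gcd[c[1],k]∣c b k n)

Cvals-divisor⇒S-divisor : ∀ b k e → CommonDivisor (Cvals b k) e → CommonDivisor (S b k) e
Cvals-divisor⇒S-divisor b k e e-cd _ (inj₁ refl)                          = e ∣0
Cvals-divisor⇒S-divisor b k e e-cd _ (inj₂ (n , a , 1≤n , _ , _ , refl)) =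
  ∣n⇒∣m*n a (e-cd _ (n , 1≤n , refl))

1+m<n*m : ∀ {m n} → 2 ≤ n → 2 ≤ m → suc m < n * m
1+m<n*m {m} {n} 2≤n 2≤m = begin-strict
  suc m      <⟨ n<1+n (suc m) ⟩
  2 + m      ≤⟨ +-monoˡ-≤ m 2≤m ⟩
  m + m      ≡⟨ cong (m +_) (+-identityʳ m) ⟨
  2 * m      ≤⟨ *-monoˡ-≤ m 2≤n ⟩
  n * m      ∎
  where open ≤-Reasoning

-- c(n) = (a + 1) c(n) - a c(n) for a = b^(n-1); for n = 1 and b = 2 only a = 1 is available.
S-divisor⇒Cvals-divisor : ∀ b k e → 2 ≤ b → CommonDivisor (S b k) e → CommonDivisor (Cvals b k) e
S-divisor⇒Cvals-divisor b k e 2≤b e-cd _ (suc zero , _ , refl) =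
  subst (e ∣_) (*-identityˡ _)
    (e-cd _ (inj₂ (1 , 1 , ≤-refl , ≤-refl , subst (1 <_) (sym (^-identityʳ b)) 2≤b , refl)))
S-divisor⇒Cvals-divisor b@(suc _) k e 2≤b e-cd _ (n@(suc (suc n-2)) , _ , refl) =
  ∣m+n∣m⇒∣n (subst (e ∣_) (+-comm (c b k n) _) e∣[1+a]c) e∣ac
  where
  a = b ^ suc n-2
  2≤a : 2 ≤ a
  2≤a = ≤-trans 2≤b (m≤m*n b (b ^ n-2) {{m^n≢0 b n-2}})
  e∣ac : e ∣ a * c b k n
  e∣ac = e-cd _ (inj₂ (n , a , s≤s z≤n , ≤-refl , ≤-trans (n≤1+n _) (1+m<n*m 2≤b 2≤a) , refl))
  e∣[1+a]c : e ∣ suc a * c b k n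
  e∣[1+a]c = e-cd _ (inj₂ (n , suc a , s≤s z≤n , n≤1+n a , 1+m<n*m 2≤b 2≤a , refl))

S-isGCDOf : ∀ b k → 2 ≤ b → 1 ≤ k → IsGCDOf (S b k) (Dk b k)
S-isGCDOf b@(suc b-1) k 2≤b 1≤k =
  isGCDOf-transfer (Cvals-divisor⇒S-divisor b k) (λ e → S-divisor⇒Cvals-divisor b k e 2≤b)
    (Cvals-isGCDOf b-1 k 1≤k)

Ck≡Dk : ∀ b k → 1 ≤ k → Ck (suc b) k ≡ Dk (suc b) k
Ck≡Dk b k@(suc k-1) 1≤k =
  isGCDOf-unique (foldr-gcd-isGCDOf terms)
    (gcd-isGCDOf Dk-cd (∈-map⁺ term (∈-upTo⁺ (s≤s z≤n))) (∈-map⁺ term (∈-upTo⁺ ≤-refl)))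
  where
  term : ℕ → ℕ
  term i = c (suc b) k (suc i)
  terms = map term (upTo k)
  Dk-cd : CommonDivisor (_∈ terms) (Dk (suc b) k)
  Dk-cd x x∈terms with ∈-map⁻ term x∈terms
  ... | i , _ , refl = proj₁ (Cvals-isGCDOf b k 1≤k) _ (suc i , s≤s z≤n , refl)

theorem1 : (b k : ℕ) → 2 ≤ b → 1 ≤ k →
    IsGCDOf (S b k) (Ek b k) × IsGCDOf (Cvals b k) (Ek b k) × Ck b k ≡ Ek b k × Dk b k ≡ Ek b k
theorem1 b@(suc (suc b-2)) k 2≤b@(s≤s (s≤s z≤n)) 1≤k =
  subst (λ d → IsGCDOf (S b k) d × IsGCDOf (Cvals b k) d × Ck b k ≡ d × Dk b k ≡ d) Dk≡Ek
    (S-isGCDOf b k 2≤b 1≤k , Cvals-isGCDOf (suc b-2) k 1≤k , Ck≡Dk (suc b-2) k 1≤k , refl)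
  where
  Dk≡Ek : Dk b k ≡ Ek b k
  Dk≡Ek = trans (Dk≡gcd[c[1],k] (suc b-2) k) (sym (Ek≡gcd[c[1],k] b-2 k))
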